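{- Let $q$ be a prime power. For integers $m,n\ge0$, \[ \beta_{m,n}=\begin{cases} q^{m-n-1}(q-1)\dfrac{q^{2n+1}+1}{q+1}&\text{if } m>n\ge0,\\[0.5em] q^n&\text{if } m=0,\\[0.3em] q^{n-m}(q-1)\dfrac{q^{2m}-1}{q+1}&\text{if } 1\le m\le n. \end{cases} \]
   Context: $\beta_{m,n}$ is the number of pairs $(f,g)$ of monic polynomials $f,g\in\mathbb F_q[X]$ with $\deg f=m$, $\deg g=n$, $f(0)\neq0$ and $\gcd(f,g)=1$. -}

module Defs where

open import Level using (0ℓ)
open import Algebra.Bundles using (CommutativeRing)
open import Data.Nat as ℕ using (ℕ; zero; suc; _∸_; _^_; _/_)
open import Data.Nat.Primality using (Prime)
open import Data.Product using (Σ; ∃; ∃-syntax; _×_; _,_)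
open import Data.Unit using (⊤)
open import Data.List using (List; []; _∷_; [_]; _++_; map; concatMap; length; filter; cartesianProduct)
open import Data.List.Relation.Unary.Any using (Any)
open import Data.List.Relation.Unary.AllPairs using (AllPairs)
open import Data.Vec using (Vec; toList)
import Data.Vec as V
open import Relation.Nullary using (¬_)
open import Relation.Unary using (Pred; Decidable)
open import Relation.Binary.PropositionalEquality using (_≡_)

IsPrimePower : ℕ → Set
IsPrimePower q = ∃[ p ] ∃[ k ] (Prime p × q ≡ p ^ suc k)

record FiniteField (q : ℕ) : Set₁ where
  field
    commRing : CommutativeRing 0ℓ 0ℓ
  open CommutativeRing commRing public hiding (ring)
  field
    1≉0     : ¬ (1# ≈ 0#)
    inverse : ∀ x → ¬ (x ≈ 0#) → ∃[ y ] (x * y ≈ 1#)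
    _≈?_    : ∀ x y → Relation.Nullary.Dec (x ≈ y)
    elems   : List Carrier
    complete : ∀ x → Any (x ≈_) elems
    distinct : AllPairs (λ x y → ¬ (x ≈ y)) elems
    card    : length elems ≡ q

module Poly {q : ℕ} (F : FiniteField q) where
  open FiniteField F

  -- polynomials as coefficient lists, lowest degree first
  Pol : Set
  Pol = List Carrier

  -- equality of polynomials (trailing zero coefficients are irrelevant)
  _≈ₚ_ : Pol → Pol → Set
  [] ≈ₚ [] = ⊤
  [] ≈ₚ (y ∷ ys) = (y ≈ 0#) × ([] ≈ₚ ys)
  (x ∷ xs) ≈ₚ [] = (x ≈ 0#) × (xs ≈ₚ [])
  (x ∷ xs) ≈ₚ (y ∷ ys) = (x ≈ y) × (xs ≈ₚ ys)

  _+ₚ_ : Pol → Pol → Pol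
  [] +ₚ ys = ys
  (x ∷ xs) +ₚ [] = x ∷ xs
  (x ∷ xs) +ₚ (y ∷ ys) = (x + y) ∷ (xs +ₚ ys)

  _*ₚ_ : Pol → Pol → Pol
  [] *ₚ ys = []
  (a ∷ xs) *ₚ ys = map (a *_) ys +ₚ (0# ∷ (xs *ₚ ys))

  oneₚ : Pol
  oneₚ = [ 1# ]

  eval0 : Pol → Carrier
  eval0 [] = 0#
  eval0 (x ∷ _) = x

  _∣ₚ_ : Pol → Pol → Set
  d ∣ₚ f = ∃[ h ] ((d *ₚ h) ≈ₚ f)

  IsUnit : Pol → Set
  IsUnit d = ∃[ e ] ((d *ₚ e) ≈ₚ oneₚ)

  Coprime : Pol → Pol → Set
  Coprime f g = ∀ d → d ∣ₚ f → d ∣ₚ g → IsUnit d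

  monic : ∀ {m} → Vec Carrier m → Pol
  monic c = toList c ++ [ 1# ]

  allVecs : (m : ℕ) → List (Vec Carrier m)
  allVecs zero = [ V.[] ]
  allVecs (suc m) = concatMap (λ x → map (x V.∷_) (allVecs m)) elems

  BetaPred : (m n : ℕ) → Pred (Vec Carrier m × Vec Carrier n) 0ℓ
  BetaPred m n (c , d) = ¬ (eval0 (monic c) ≈ 0#) × Coprime (monic c) (monic d)

  -- "β_{m,n} = N": the number of pairs (f,g) of monic polynomials with
  -- deg f = m, deg g = n, f(0) ≠ 0, gcd(f,g) = 1 equals N
  -- (the count is independent of the chosen decision procedure).
  BetaIs : (m n N : ℕ) → Set
  BetaIs m n N = Σ (Decidable (BetaPred m n)) λ dec →
    length (filter dec (cartesianProduct (allVecs m) (allVecs n))) ≡ N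

-- the closed formula from the statement (all divisions are exact)
betaFormula : ℕ → ℕ → ℕ → ℕ
betaFormula q zero n = q ^ n
betaFormula q (suc m') n with n ℕ.<? suc m'
... | Relation.Nullary.yes _ = q ^ (suc m' ∸ n ∸ 1) ℕ.* (q ∸ 1) ℕ.* ((q ^ (2 ℕ.* n ℕ.+ 1) ℕ.+ 1) / suc q)
... | Relation.Nullary.no _ = q ^ (n ∸ suc m') ℕ.* (q ∸ 1) ℕ.* ((q ^ (2 ℕ.* suc m') ∸ 1) / suc q)

-- Write C(m,n) (#coprime below) for the number of coprime pairs of monic polynomials of
-- degrees m and n, and E(m,n) (#coprimeAny) for the number of coprime pairs (f, g) with f
-- monic of degree m and g any polynomial of degree < n.
-- Splitting monic f of degree m+1 by f(0), and using that X·f' is coprime to g exactly when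
-- f' is and g(0) ≠ 0, gives β(m+1,n) + β(n,m) = C(m+1,n).  For n ≥ m, subtracting multiples
-- of f permutes the polynomials with a fixed leading coefficient, so E(m,n+1) = q·E(m,n) and
-- C(m,n) = E(m,n); splitting g by its leading coefficient (zero, or a unit that can be scaled
-- away) gives E(m,n+1) = E(m,n) + (q−1)·C(m,n).  With the symmetry of C these determine
-- C(m,n) = (q−1)·q^(m+n−1) for m,n ≥ 1, and the formula for β follows by induction on m+n.
-- Coprimality is decided, as the count requires, by Euclid's algorithm.

module Submission where

open import Defs
open import Level using (Level; 0ℓ)
open import Algebra.Bundles using (CommutativeRing)
import Algebra.Properties.CommutativeSemigroup as CommutativeSemigroupProperties
import Algebra.Properties.Ring as RingProperties
open import Data.Nat as Nat using (ℕ; zero; suc; _≤_; _<_; z≤n; s≤s; _≤′_; ≤′-refl; ≤′-step)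
import Data.Nat.Properties as ℕₚ
open import Data.Nat.DivMod using (m*n/n≡m)
open import Data.Nat.Induction using (<-rec)
open import Data.Nat.Tactic.RingSolver using (solve-∀)
open import Data.List using (List; []; _∷_; _++_; [_]; map; concatMap; drop; length; filter; cartesianProduct)
open import Data.List.Reverse using (Reverse; []; _∶_∶ʳ_; reverseView)
open import Data.List.Relation.Unary.Any using (Any; here; there)
open import Data.List.Relation.Unary.All as All using (All; []; _∷_)
open import Data.List.Relation.Unary.All.Properties using (All¬⇒¬Any)
open import Data.List.Relation.Unary.AllPairs using (AllPairs; []; _∷_)
open import Data.Vec as Vec using (Vec; []; _∷_; _∷ʳ_; toList; zipWith)
open import Data.Vec.Properties using (toList-∷ʳ)
open import Data.Vec.Relation.Binary.Pointwise.Inductive as Pointwise using (Pointwise; []; _∷_)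
open import Data.Product using (Σ-syntax; _×_; _,_; proj₁; proj₂)
open import Data.Unit using (tt)
open import Function.Bundles using (_⇔_; mk⇔; Equivalence; Inverse)
open import Function.Properties.Equivalence using (⇔-setoid)
open import Relation.Binary using (Setoid; IsEquivalence; _Preserves_⟶_)
import Relation.Binary.PropositionalEquality as ≡
open ≡ using (_≡_)
import Relation.Binary.Reasoning.Setoid as SetoidReasoning
open import Relation.Nullary using (¬_; Dec; yes; no; ¬?; _×-dec_; contradiction)
import Relation.Nullary.Decidable as Dec
open import Relation.Unary using (Pred; Decidable)

module ListSums where

  open Nat using (_+_; _*_)
  open ≡ using (refl; sym; trans; cong; cong₂)
  open ≡.≡-Reasoning
  open ℕₚ using (+-assoc; *-zeroʳ; *-distribˡ-+; *-distribʳ-+)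
  open CommutativeSemigroupProperties ℕₚ.+-commutativeSemigroup using (interchange)

  private
    variable
      a b : Level
      A B : Set a

  indicator : ∀ {p} {P : Set p} → Dec P → ℕ
  indicator (yes _) = 1
  indicator (no _)  = 0

  indicator-⇔ : ∀ {P Q : Set a} → P ⇔ Q → (P? : Dec P) (Q? : Dec Q) → indicator P? ≡ indicator Q?
  indicator-⇔ P⇔Q (yes _) (yes _) = refl
  indicator-⇔ P⇔Q (yes p) (no ¬q) = contradiction (Equivalence.to P⇔Q p) ¬q
  indicator-⇔ P⇔Q (no ¬p) (yes q) = contradiction (Equivalence.from P⇔Q q) ¬p
  indicator-⇔ P⇔Q (no _)  (no _)  = refl

  indicator-yes : ∀ {P : Set a} → P → (P? : Dec P) → indicator P? ≡ 1
  indicator-yes p (yes _) = refl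
  indicator-yes p (no ¬p) = contradiction p ¬p

  indicator-no : ∀ {P : Set a} → ¬ P → (P? : Dec P) → indicator P? ≡ 0
  indicator-no ¬p (yes p) = contradiction p ¬p
  indicator-no ¬p (no _)  = refl

  sumOver : List A → (A → ℕ) → ℕ
  sumOver []       f = 0
  sumOver (x ∷ xs) f = f x + sumOver xs f

  syntax sumOver xs (λ x → e) = ∑[ x ∈ xs ] e

  sumOver-cong : ∀ xs {f g : A → ℕ} → (∀ x → f x ≡ g x) → sumOver xs f ≡ sumOver xs g
  sumOver-cong []       f≗g = refl
  sumOver-cong (x ∷ xs) f≗g = cong₂ _+_ (f≗g x) (sumOver-cong xs f≗g)

  sumOver-+ : ∀ xs (f g : A → ℕ) → ∑[ x ∈ xs ] (f x + g x) ≡ sumOver xs f + sumOver xs g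
  sumOver-+ []       f g = refl
  sumOver-+ (x ∷ xs) f g = begin
    f x + g x + ∑[ x ∈ xs ] (f x + g x)         ≡⟨ cong (f x + g x +_) (sumOver-+ xs f g) ⟩
    f x + g x + (sumOver xs f + sumOver xs g)   ≡⟨ interchange (f x) (g x) _ _ ⟩
    f x + sumOver xs f + (g x + sumOver xs g)   ∎

  sumOver-*ˡ : ∀ xs k (f : A → ℕ) → ∑[ x ∈ xs ] (k * f x) ≡ k * sumOver xs f
  sumOver-*ˡ []       k f = sym (*-zeroʳ k)
  sumOver-*ˡ (x ∷ xs) k f =
    trans (cong (k * f x +_) (sumOver-*ˡ xs k f)) (sym (*-distribˡ-+ k (f x) _))

  sumOver-*ʳ : ∀ xs (f : A → ℕ) k → ∑[ x ∈ xs ] (f x * k) ≡ sumOver xs f * k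
  sumOver-*ʳ []       f k = refl
  sumOver-*ʳ (x ∷ xs) f k = trans (cong (f x * k +_) (sumOver-*ʳ xs f k)) (sym (*-distribʳ-+ k (f x) _))

  sumOver-const : ∀ (xs : List A) k → ∑[ _ ∈ xs ] k ≡ length xs * k
  sumOver-const []       k = refl
  sumOver-const (x ∷ xs) k = cong (k +_) (sumOver-const xs k)

  sumOver-++ : ∀ xs ys (f : A → ℕ) → sumOver (xs ++ ys) f ≡ sumOver xs f + sumOver ys f
  sumOver-++ []       ys f = refl
  sumOver-++ (x ∷ xs) ys f = trans (cong (f x +_) (sumOver-++ xs ys f)) (sym (+-assoc (f x) _ _))

  length-filter≡sumOver-indicator : ∀ {p} {P : Pred A p} (P? : Decidable P) xs →
    length (filter P? xs) ≡ ∑[ x ∈ xs ] indicator (P? x)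
  length-filter≡sumOver-indicator P? [] = refl
  length-filter≡sumOver-indicator P? (x ∷ xs) with P? x
  ... | yes _ = cong suc (length-filter≡sumOver-indicator P? xs)
  ... | no  _ = length-filter≡sumOver-indicator P? xs

  sumOver-map : ∀ (g : A → B) xs (f : B → ℕ) → sumOver (map g xs) f ≡ ∑[ x ∈ xs ] f (g x)
  sumOver-map g []       f = refl
  sumOver-map g (x ∷ xs) f = cong (f (g x) +_) (sumOver-map g xs f)

  sumOver-concatMap : ∀ (h : A → List B) xs (f : B → ℕ) →
    sumOver (concatMap h xs) f ≡ ∑[ x ∈ xs ] sumOver (h x) f
  sumOver-concatMap h []       f = refl
  sumOver-concatMap h (x ∷ xs) f =
    trans (sumOver-++ (h x) (concatMap h xs) f) (cong (sumOver (h x) f +_) (sumOver-concatMap h xs f))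

  sumOver-swap : ∀ (xs : List A) (ys : List B) (h : A → B → ℕ) →
    ∑[ x ∈ xs ] ∑[ y ∈ ys ] h x y ≡ ∑[ y ∈ ys ] ∑[ x ∈ xs ] h x y
  sumOver-swap []       ys h = sym (trans (sumOver-const ys 0) (*-zeroʳ (length ys)))
  sumOver-swap (x ∷ xs) ys h = begin
    sumOver ys (h x) + ∑[ x ∈ xs ] sumOver ys (h x)
      ≡⟨ cong (sumOver ys (h x) +_) (sumOver-swap xs ys h) ⟩
    sumOver ys (h x) + ∑[ y ∈ ys ] ∑[ x ∈ xs ] h x y
      ≡⟨ sumOver-+ ys (h x) _ ⟨
    ∑[ y ∈ ys ] (h x y + ∑[ x ∈ xs ] h x y) ∎

  sumOver-cartesianProduct : ∀ xs ys (f : A × B → ℕ) →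
    sumOver (cartesianProduct xs ys) f ≡ ∑[ x ∈ xs ] ∑[ y ∈ ys ] f (x , y)
  sumOver-cartesianProduct []       ys f = refl
  sumOver-cartesianProduct (x ∷ xs) ys f = trans (sumOver-++ (map (x ,_) ys) _ f)
    (cong₂ _+_ (sumOver-map (x ,_) ys f) (sumOver-cartesianProduct xs ys f))

open ListSums

module Polynomials {q : ℕ} (F : FiniteField q) where

  open FiniteField F
  open Poly F
  open SetoidReasoning setoid
  open CommutativeSemigroupProperties +-commutativeSemigroup using (interchange)

  coeff : ℕ → Pol → Carrier
  coeff i       []       = 0#
  coeff zero    (x ∷ xs) = x
  coeff (suc i) (x ∷ xs) = coeff i xs

  coeff-cong : ∀ {a b} → a ≈ₚ b → ∀ i → coeff i a ≈ coeff i b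
  coeff-cong {[]}     {[]}     _          i       = refl
  coeff-cong {[]}     {y ∷ ys} (y≈0 , _)  zero    = sym y≈0
  coeff-cong {[]}     {y ∷ ys} (_ , e)    (suc i) = coeff-cong {[]} {ys} e i
  coeff-cong {x ∷ xs} {[]}     (x≈0 , _)  zero    = x≈0
  coeff-cong {x ∷ xs} {[]}     (_ , e)    (suc i) = coeff-cong {xs} {[]} e i
  coeff-cong {x ∷ xs} {y ∷ ys} (x≈y , _)  zero    = x≈y
  coeff-cong {x ∷ xs} {y ∷ ys} (_ , e)    (suc i) = coeff-cong {xs} {ys} e i

  ≈ₚ-by-coeff : ∀ a b → (∀ i → coeff i a ≈ coeff i b) → a ≈ₚ b
  ≈ₚ-by-coeff []       []       h = tt
  ≈ₚ-by-coeff []       (y ∷ ys) h = sym (h 0) , ≈ₚ-by-coeff [] ys (λ i → h (suc i))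
  ≈ₚ-by-coeff (x ∷ xs) []       h = h 0 , ≈ₚ-by-coeff xs [] (λ i → h (suc i))
  ≈ₚ-by-coeff (x ∷ xs) (y ∷ ys) h = h 0 , ≈ₚ-by-coeff xs ys (λ i → h (suc i))

  ≈ₚ-isEquivalence : IsEquivalence _≈ₚ_
  ≈ₚ-isEquivalence = record
    { refl  = λ {a} → ≈ₚ-by-coeff a a (λ _ → refl)
    ; sym   = λ {a} {b} e → ≈ₚ-by-coeff b a (λ i → sym (coeff-cong e i))
    ; trans = λ {a} {b} {c} e f → ≈ₚ-by-coeff a c (λ i → trans (coeff-cong e i) (coeff-cong {b} f i))
    }

  ≈ₚ-setoid : Setoid _ _
  ≈ₚ-setoid = record { isEquivalence = ≈ₚ-isEquivalence }

  open Setoid ≈ₚ-setoid public using ()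
    renaming (refl to ≈ₚ-refl; sym to ≈ₚ-sym; trans to ≈ₚ-trans; reflexive to ≈ₚ-reflexive)
  module ≈ₚ-Reasoning = SetoidReasoning ≈ₚ-setoid

  eval0≡coeff0 : ∀ a → eval0 a ≡.≡ coeff 0 a
  eval0≡coeff0 []      = ≡.refl
  eval0≡coeff0 (x ∷ a) = ≡.refl

  eval0-cong : ∀ {a b} → a ≈ₚ b → eval0 a ≈ eval0 b
  eval0-cong {a} {b} e rewrite eval0≡coeff0 a | eval0≡coeff0 b = coeff-cong e 0

  coeff-+ₚ : ∀ a b i → coeff i (a +ₚ b) ≈ coeff i a + coeff i b
  coeff-+ₚ []       b        i       = sym (+-identityˡ _)
  coeff-+ₚ (x ∷ xs) []       i       = sym (+-identityʳ _)
  coeff-+ₚ (x ∷ xs) (y ∷ ys) zero    = refl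
  coeff-+ₚ (x ∷ xs) (y ∷ ys) (suc i) = coeff-+ₚ xs ys i

  coeff-scale : ∀ c a i → coeff i (map (c *_) a) ≈ c * coeff i a
  coeff-scale c []       i       = sym (zeroʳ c)
  coeff-scale c (x ∷ xs) zero    = refl
  coeff-scale c (x ∷ xs) (suc i) = coeff-scale c xs i

  +ₚ-identityʳ : ∀ a → a +ₚ [] ≡.≡ a
  +ₚ-identityʳ []      = ≡.refl
  +ₚ-identityʳ (x ∷ a) = ≡.refl

  +ₚ-cong : ∀ {a a' b b'} → a ≈ₚ a' → b ≈ₚ b' → (a +ₚ b) ≈ₚ (a' +ₚ b')
  +ₚ-cong {a} {a'} {b} {b'} e f = ≈ₚ-by-coeff _ _ λ i → begin
    coeff i (a +ₚ b)          ≈⟨ coeff-+ₚ a b i ⟩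
    coeff i a + coeff i b     ≈⟨ +-cong (coeff-cong e i) (coeff-cong f i) ⟩
    coeff i a' + coeff i b'   ≈⟨ coeff-+ₚ a' b' i ⟨
    coeff i (a' +ₚ b')        ∎

  +ₚ-interchange : ∀ a b c d → ((a +ₚ b) +ₚ (c +ₚ d)) ≈ₚ ((a +ₚ c) +ₚ (b +ₚ d))
  +ₚ-interchange a b c d = ≈ₚ-by-coeff _ _ λ i → begin
    coeff i ((a +ₚ b) +ₚ (c +ₚ d))
      ≈⟨ trans (coeff-+ₚ (a +ₚ b) (c +ₚ d) i) (+-cong (coeff-+ₚ a b i) (coeff-+ₚ c d i)) ⟩
    (coeff i a + coeff i b) + (coeff i c + coeff i d)
      ≈⟨ interchange _ _ _ _ ⟩
    (coeff i a + coeff i c) + (coeff i b + coeff i d)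
      ≈⟨ trans (coeff-+ₚ (a +ₚ c) (b +ₚ d) i) (+-cong (coeff-+ₚ a c i) (coeff-+ₚ b d i)) ⟨
    coeff i ((a +ₚ c) +ₚ (b +ₚ d)) ∎

  scale-cong : ∀ {c c' a a'} → c ≈ c' → a ≈ₚ a' → map (c *_) a ≈ₚ map (c' *_) a'
  scale-cong {c} {c'} {a} {a'} e f = ≈ₚ-by-coeff _ _ λ i → begin
    coeff i (map (c *_) a)    ≈⟨ coeff-scale c a i ⟩
    c * coeff i a             ≈⟨ *-cong e (coeff-cong f i) ⟩
    c' * coeff i a'           ≈⟨ coeff-scale c' a' i ⟨
    coeff i (map (c' *_) a')  ∎

  scale-distribˡ : ∀ c a b → map (c *_) (a +ₚ b) ≈ₚ (map (c *_) a +ₚ map (c *_) b)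
  scale-distribˡ c a b = ≈ₚ-by-coeff _ _ λ i → begin
    coeff i (map (c *_) (a +ₚ b))   ≈⟨ trans (coeff-scale c (a +ₚ b) i) (*-congˡ (coeff-+ₚ a b i)) ⟩
    c * (coeff i a + coeff i b)     ≈⟨ distribˡ c _ _ ⟩
    c * coeff i a + c * coeff i b
      ≈⟨ trans (coeff-+ₚ (map (c *_) a) (map (c *_) b) i) (+-cong (coeff-scale c a i) (coeff-scale c b i)) ⟨
    coeff i (map (c *_) a +ₚ map (c *_) b) ∎

  scale-distribʳ : ∀ c d a → map ((c + d) *_) a ≈ₚ (map (c *_) a +ₚ map (d *_) a)
  scale-distribʳ c d a = ≈ₚ-by-coeff _ _ λ i → begin
    coeff i (map ((c + d) *_) a)    ≈⟨ coeff-scale _ a i ⟩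
    (c + d) * coeff i a             ≈⟨ distribʳ _ c d ⟩
    c * coeff i a + d * coeff i a
      ≈⟨ trans (coeff-+ₚ (map (c *_) a) (map (d *_) a) i) (+-cong (coeff-scale c a i) (coeff-scale d a i)) ⟨
    coeff i (map (c *_) a +ₚ map (d *_) a) ∎

  scale-zero : ∀ {c} a → c ≈ 0# → map (c *_) a ≈ₚ []
  scale-zero {c} a c≈0 = ≈ₚ-by-coeff _ _ λ i → trans (coeff-scale c a i) (trans (*-congʳ c≈0) (zeroˡ _))

  scale-scale : ∀ c d a → map (c *_) (map (d *_) a) ≈ₚ map ((c * d) *_) a
  scale-scale c d a = ≈ₚ-by-coeff _ _ λ i → begin
    coeff i (map (c *_) (map (d *_) a))
      ≈⟨ trans (coeff-scale c (map (d *_) a) i) (*-congˡ (coeff-scale d a i)) ⟩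
    c * (d * coeff i a)
      ≈⟨ *-assoc c d _ ⟨
    (c * d) * coeff i a
      ≈⟨ coeff-scale _ a i ⟨
    coeff i (map ((c * d) *_) a) ∎

  *ₚ-zeroʳ : ∀ d → (d *ₚ []) ≈ₚ []
  *ₚ-zeroʳ []       = tt
  *ₚ-zeroʳ (a ∷ ds) = refl , *ₚ-zeroʳ ds

  *ₚ-zeroˡ : ∀ x c → x ≈ₚ [] → (x *ₚ c) ≈ₚ []
  *ₚ-zeroˡ []       c _          = tt
  *ₚ-zeroˡ (a ∷ xs) c (a≈0 , e) =
    +ₚ-cong {a' = []} {b' = []} (scale-zero c a≈0) (refl , *ₚ-zeroˡ xs c e)

  *ₚ-congʳ : ∀ {x y} c → x ≈ₚ y → (x *ₚ c) ≈ₚ (y *ₚ c)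
  *ₚ-congʳ {[]}     {[]}     c _ = tt
  *ₚ-congʳ {[]}     {b ∷ ys} c e = ≈ₚ-sym (*ₚ-zeroˡ (b ∷ ys) c (≈ₚ-sym {[]} {b ∷ ys} e))
  *ₚ-congʳ {a ∷ xs} {[]}     c e = *ₚ-zeroˡ (a ∷ xs) c e
  *ₚ-congʳ {a ∷ xs} {b ∷ ys} c (a≈b , e) =
    +ₚ-cong (scale-cong a≈b (≈ₚ-refl {c})) (refl , *ₚ-congʳ c e)

  *ₚ-congˡ : ∀ d {x y} → x ≈ₚ y → (d *ₚ x) ≈ₚ (d *ₚ y)
  *ₚ-congˡ []       e = tt
  *ₚ-congˡ (a ∷ ds) e = +ₚ-cong (scale-cong refl e) (refl , *ₚ-congˡ ds e)

  *ₚ-distribʳ : ∀ x y c → ((x +ₚ y) *ₚ c) ≈ₚ ((x *ₚ c) +ₚ (y *ₚ c))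
  *ₚ-distribʳ []       y        c = ≈ₚ-refl
  *ₚ-distribʳ (a ∷ xs) []       c = ≈ₚ-reflexive (≡.sym (+ₚ-identityʳ ((a ∷ xs) *ₚ c)))
  *ₚ-distribʳ (a ∷ xs) (b ∷ ys) c = ≈ₚ-trans
    (+ₚ-cong (scale-distribʳ a b c) (sym (+-identityʳ 0#) , *ₚ-distribʳ xs ys c))
    (+ₚ-interchange (map (a *_) c) (map (b *_) c) (0# ∷ (xs *ₚ c)) (0# ∷ (ys *ₚ c)))

  *ₚ-distribˡ : ∀ d x y → (d *ₚ (x +ₚ y)) ≈ₚ ((d *ₚ x) +ₚ (d *ₚ y))
  *ₚ-distribˡ []       x y = tt
  *ₚ-distribˡ (a ∷ ds) x y = ≈ₚ-trans
    (+ₚ-cong (scale-distribˡ a x y) (sym (+-identityʳ 0#) , *ₚ-distribˡ ds x y))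
    (+ₚ-interchange (map (a *_) x) (map (a *_) y) (0# ∷ (ds *ₚ x)) (0# ∷ (ds *ₚ y)))

  scale-*ₚ : ∀ a b c → ((map (a *_) b) *ₚ c) ≈ₚ map (a *_) (b *ₚ c)
  scale-*ₚ a []        c = tt
  scale-*ₚ a (b₀ ∷ bs) c = ≈ₚ-trans
    (+ₚ-cong (≈ₚ-sym (scale-scale a b₀ c)) (sym (zeroʳ a) , scale-*ₚ a bs c))
    (≈ₚ-sym (scale-distribˡ a (map (b₀ *_) c) (0# ∷ (bs *ₚ c))))

  shift-*ₚ : ∀ p c → ((0# ∷ p) *ₚ c) ≈ₚ (0# ∷ (p *ₚ c))
  shift-*ₚ p c = +ₚ-cong {a' = []} (scale-zero c refl) (≈ₚ-refl {0# ∷ (p *ₚ c)})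

  *ₚ-shift : ∀ d t → (d *ₚ (0# ∷ t)) ≈ₚ (0# ∷ (d *ₚ t))
  *ₚ-shift []       t = refl , tt
  *ₚ-shift (a ∷ ds) t = trans (+-identityʳ _) (zeroʳ a) , +ₚ-cong (≈ₚ-refl {map (a *_) t}) (*ₚ-shift ds t)

  *ₚ-assoc : ∀ x y z → ((x *ₚ y) *ₚ z) ≈ₚ (x *ₚ (y *ₚ z))
  *ₚ-assoc []       y z = tt
  *ₚ-assoc (a ∷ xs) y z = ≈ₚ-trans (*ₚ-distribʳ (map (a *_) y) (0# ∷ (xs *ₚ y)) z)
    (+ₚ-cong (scale-*ₚ a y z) (≈ₚ-trans (shift-*ₚ (xs *ₚ y) z) (refl , *ₚ-assoc xs y z)))

  *ₚ-constant : ∀ d c → (d *ₚ [ c ]) ≈ₚ map (_* c) d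
  *ₚ-constant []       c = tt
  *ₚ-constant (a ∷ ds) c = +-identityʳ _ , *ₚ-constant ds c

  *ₚ-identityʳ : ∀ d → (d *ₚ oneₚ) ≈ₚ d
  *ₚ-identityʳ d = ≈ₚ-trans (*ₚ-constant d 1#) (map-*1 d)
    where
    map-*1 : ∀ d → map (_* 1#) d ≈ₚ d
    map-*1 []      = tt
    map-*1 (x ∷ d) = *-identityʳ x , map-*1 d

  *ₚ-identityˡ : ∀ p → (oneₚ *ₚ p) ≈ₚ p
  *ₚ-identityˡ p = ≈ₚ-by-coeff _ _ λ i → begin
    coeff i (map (1# *_) p +ₚ [ 0# ])           ≈⟨ coeff-+ₚ (map (1# *_) p) [ 0# ] i ⟩
    coeff i (map (1# *_) p) + coeff i [ 0# ]    ≈⟨ +-cong (coeff-scale 1# p i) (coeff-single0 i) ⟩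
    1# * coeff i p + 0#                         ≈⟨ trans (+-identityʳ _) (*-identityˡ _) ⟩
    coeff i p                                   ∎
    where
    coeff-single0 : ∀ i → coeff i [ 0# ] ≈ 0#
    coeff-single0 zero    = refl
    coeff-single0 (suc i) = refl

  eval0-*ₚ : ∀ a b → eval0 (a *ₚ b) ≈ eval0 a * eval0 b
  eval0-*ₚ []       b = sym (zeroˡ _)
  eval0-*ₚ (x ∷ xs) b = begin
    eval0 (map (x *_) b +ₚ (0# ∷ (xs *ₚ b)))   ≡⟨ eval0≡coeff0 (map (x *_) b +ₚ (0# ∷ (xs *ₚ b))) ⟩
    coeff 0 (map (x *_) b +ₚ (0# ∷ (xs *ₚ b))) ≈⟨ coeff-+ₚ (map (x *_) b) (0# ∷ (xs *ₚ b)) 0 ⟩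
    coeff 0 (map (x *_) b) + 0#                 ≈⟨ +-identityʳ _ ⟩
    coeff 0 (map (x *_) b)                      ≈⟨ coeff-scale x b 0 ⟩
    x * coeff 0 b                               ≡⟨ ≡.cong (x *_) (eval0≡coeff0 b) ⟨
    x * eval0 b                                 ∎

module Divisibility {q : ℕ} (F : FiniteField q) where

  open FiniteField F
  open Poly F
  open Polynomials F

  ∣ₚ-respʳ : ∀ d {a b} → a ≈ₚ b → d ∣ₚ a → d ∣ₚ b
  ∣ₚ-respʳ d a≈b (h , dh≈a) = h , ≈ₚ-trans dh≈a a≈b

  ∣ₚ-refl : ∀ d → d ∣ₚ d
  ∣ₚ-refl d = oneₚ , *ₚ-identityʳ d

  ∣ₚ-+ₚ-*ₚ : ∀ {d a b} → d ∣ₚ a → d ∣ₚ b → ∀ w → d ∣ₚ (a +ₚ (b *ₚ w))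
  ∣ₚ-+ₚ-*ₚ {d} {a} {b} (h₁ , dh₁≈a) (h₂ , dh₂≈b) w = h₁ +ₚ (h₂ *ₚ w) , (begin
    d *ₚ (h₁ +ₚ (h₂ *ₚ w))           ≈⟨ *ₚ-distribˡ d h₁ (h₂ *ₚ w) ⟩
    (d *ₚ h₁) +ₚ (d *ₚ (h₂ *ₚ w))    ≈⟨ +ₚ-cong dh₁≈a (≈ₚ-sym (*ₚ-assoc d h₂ w)) ⟩
    a +ₚ ((d *ₚ h₂) *ₚ w)            ≈⟨ +ₚ-cong (≈ₚ-refl {a}) (*ₚ-congʳ w dh₂≈b) ⟩
    a +ₚ (b *ₚ w)                    ∎)
    where open ≈ₚ-Reasoning

  ∣ₚ-*ₚʳ : ∀ {d b} → d ∣ₚ b → ∀ w → d ∣ₚ (b *ₚ w)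
  ∣ₚ-*ₚʳ {d} = ∣ₚ-+ₚ-*ₚ {d} {[]} ([] , *ₚ-zeroʳ d)

  Coprime-congˡ : ∀ {f f' g} → f ≈ₚ f' → Coprime f g ⇔ Coprime f' g
  Coprime-congˡ f≈f' = mk⇔
    (λ cop d d∣f' → cop d (∣ₚ-respʳ d (≈ₚ-sym f≈f') d∣f'))
    (λ cop d d∣f → cop d (∣ₚ-respʳ d f≈f' d∣f))

  Coprime-congʳ : ∀ {f g g'} → g ≈ₚ g' → Coprime f g ⇔ Coprime f g'
  Coprime-congʳ g≈g' = mk⇔
    (λ cop d d∣f d∣g' → cop d d∣f (∣ₚ-respʳ d (≈ₚ-sym g≈g') d∣g'))
    (λ cop d d∣f d∣g → cop d d∣f (∣ₚ-respʳ d g≈g' d∣g))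

  Coprime-comm : ∀ {f g} → Coprime f g ⇔ Coprime g f
  Coprime-comm = mk⇔ (λ cop d d∣g d∣f → cop d d∣f d∣g) (λ cop d d∣f d∣g → cop d d∣g d∣f)

  Coprime-+ₚ-*ₚ : ∀ {f g g'} w → (g' +ₚ (f *ₚ w)) ≈ₚ g → Coprime f g → Coprime f g'
  Coprime-+ₚ-*ₚ w e cop d d∣f d∣g' = cop d d∣f (∣ₚ-respʳ d e (∣ₚ-+ₚ-*ₚ {d} d∣g' d∣f w))

  Coprime-*ₚ : ∀ {f g g'} w → (g' *ₚ w) ≈ₚ g → Coprime f g → Coprime f g'
  Coprime-*ₚ w e cop d d∣f d∣g' = cop d d∣f (∣ₚ-respʳ d e (∣ₚ-*ₚʳ {d} d∣g' w))

  Coprime-oneₚ : ∀ g → Coprime oneₚ g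
  Coprime-oneₚ g d d∣1 _ = d∣1

  coeff-beyond-∷ʳ : ∀ k es a → coeff (suc (k Nat.+ length es)) (es ++ [ a ]) ≈ 0#
  coeff-beyond-∷ʳ k []       a = refl
  coeff-beyond-∷ʳ k (x ∷ es) a rewrite ℕₚ.+-suc k (length es) = coeff-beyond-∷ʳ k es a

  coeff-∷ʳ-last : ∀ es a → coeff (length es) (es ++ [ a ]) ≈ a
  coeff-∷ʳ-last []       a = refl
  coeff-∷ʳ-last (x ∷ es) a = coeff-∷ʳ-last es a

  coeff-top-*ₚ : ∀ cs es a → coeff (length cs Nat.+ length es) ((cs ++ [ 1# ]) *ₚ (es ++ [ a ])) ≈ a
  coeff-top-*ₚ []       es a = trans (coeff-cong (*ₚ-identityˡ (es ++ [ a ])) (length es)) (coeff-∷ʳ-last es a)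
  coeff-top-*ₚ (c ∷ cs) es a = begin
    coeff (suc n) (map (c *_) e +ₚ (0# ∷ (f *ₚ e)))
      ≈⟨ coeff-+ₚ (map (c *_) e) (0# ∷ (f *ₚ e)) (suc n) ⟩
    coeff (suc n) (map (c *_) e) + coeff n (f *ₚ e)
      ≈⟨ +-cong c*0≈0 (coeff-top-*ₚ cs es a) ⟩
    0# + a
      ≈⟨ +-identityˡ a ⟩
    a ∎
    where
    open SetoidReasoning setoid
    e = es ++ [ a ]
    f = cs ++ [ 1# ]
    n = length cs Nat.+ length es
    c*0≈0 : coeff (suc n) (map (c *_) e) ≈ 0#
    c*0≈0 = trans (coeff-scale c e (suc n)) (trans (*-congˡ (coeff-beyond-∷ʳ (length cs) es a)) (zeroʳ c))

  ∷ʳ-zero : ∀ es {a} → a ≈ 0# → (es ++ [ a ]) ≈ₚ es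
  ∷ʳ-zero []       a≈0 = a≈0 , tt
  ∷ʳ-zero (x ∷ es) a≈0 = refl , ∷ʳ-zero es a≈0

  monic-not-unit : ∀ c cs → ¬ IsUnit ((c ∷ cs) ++ [ 1# ])
  monic-not-unit c cs (e , fe≈1) = go (reverseView e) fe≈1
    where
    f = (c ∷ cs) ++ [ 1# ]
    go : ∀ {e} → Reverse e → ¬ ((f *ₚ e) ≈ₚ oneₚ)
    go []             f0≈1 =
      1≉0 (proj₁ (≈ₚ-trans {[]} {f *ₚ []} {oneₚ} (≈ₚ-sym {f *ₚ []} {[]} (*ₚ-zeroʳ f)) f0≈1))
    go (es ∶ rs ∶ʳ a) fe≈1 = go rs (≈ₚ-trans (*ₚ-congˡ f (≈ₚ-sym (∷ʳ-zero es a≈0))) fe≈1)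
      where
      a≈0 : a ≈ 0#
      a≈0 = trans (sym (coeff-top-*ₚ (c ∷ cs) es a)) (coeff-cong fe≈1 (suc (length cs Nat.+ length es)))

  monic-not-Coprime-[] : ∀ c cs → ¬ Coprime ((c ∷ cs) ++ [ 1# ]) []
  monic-not-Coprime-[] c cs cop = monic-not-unit c cs (cop f (∣ₚ-refl f) ([] , *ₚ-zeroʳ f))
    where f = (c ∷ cs) ++ [ 1# ]

  Xₚ : Pol
  Xₚ = 0# ∷ oneₚ

  Xₚ-*ₚ : ∀ p → (Xₚ *ₚ p) ≈ₚ (0# ∷ p)
  Xₚ-*ₚ p = ≈ₚ-trans (shift-*ₚ oneₚ p) (refl , *ₚ-identityˡ p)

  eval0-∣ₚ : ∀ {d g} → d ∣ₚ g → eval0 d ≈ 0# → eval0 g ≈ 0#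
  eval0-∣ₚ {d} {g} (k , dk≈g) d₀≈0 = begin
    eval0 g             ≈⟨ eval0-cong dk≈g ⟨
    eval0 (d *ₚ k)      ≈⟨ eval0-*ₚ d k ⟩
    eval0 d * eval0 k   ≈⟨ *-congʳ d₀≈0 ⟩
    0# * eval0 k        ≈⟨ zeroˡ _ ⟩
    0#                  ∎
    where open SetoidReasoning setoid

  Xₚ-not-unit : ¬ IsUnit Xₚ
  Xₚ-not-unit (e , Xe≈1) = 1≉0 (eval0-∣ₚ {Xₚ} (e , Xe≈1) refl)

  zero-product : ∀ {x y} → ¬ (x ≈ 0#) → x * y ≈ 0# → y ≈ 0#
  zero-product {x} {y} x≉0 xy≈0 with inverse x x≉0
  ... | x⁻¹ , xx⁻¹≈1 = begin
    y              ≈⟨ *-identityˡ y ⟨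
    1# * y         ≈⟨ *-congʳ (trans (sym xx⁻¹≈1) (*-comm x x⁻¹)) ⟩
    (x⁻¹ * x) * y  ≈⟨ *-assoc x⁻¹ x y ⟩
    x⁻¹ * (x * y)  ≈⟨ *-congˡ xy≈0 ⟩
    x⁻¹ * 0#       ≈⟨ zeroʳ x⁻¹ ⟩
    0#             ∎
    where open SetoidReasoning setoid

  0∷-drop : ∀ g → eval0 g ≈ 0# → g ≈ₚ (0# ∷ drop 1 g)
  0∷-drop []      _   = refl , tt
  0∷-drop (x ∷ g) x≈0 = x≈0 , ≈ₚ-refl {g}

  Coprime-Xₚ-*ₚ : ∀ f g → Coprime (0# ∷ f) g ⇔ (Coprime f g × ¬ (eval0 g ≈ 0#))
  Coprime-Xₚ-*ₚ f g = mk⇔ to from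
    where
    to : Coprime (0# ∷ f) g → Coprime f g × ¬ (eval0 g ≈ 0#)
    to cop = (λ d (h , dh≈f) d∣g → cop d (0# ∷ h , ≈ₚ-trans (*ₚ-shift d h) (refl , dh≈f)) d∣g)
           , λ g₀≈0 → Xₚ-not-unit (cop Xₚ (f , Xₚ-*ₚ f) (X∣g g₀≈0))
      where
      X∣g : eval0 g ≈ 0# → Xₚ ∣ₚ g
      X∣g g₀≈0 = drop 1 g , ≈ₚ-trans (Xₚ-*ₚ (drop 1 g)) (≈ₚ-sym (0∷-drop g g₀≈0))
    from : Coprime f g × ¬ (eval0 g ≈ 0#) → Coprime (0# ∷ f) g
    from (cop , g₀≉0) d (h , dh≈0∷f) d∣g = cop d (drop 1 h , proj₂ dh'≈0∷f) d∣g
      where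
      h₀≈0 : eval0 h ≈ 0#
      h₀≈0 = zero-product (λ d₀≈0 → g₀≉0 (eval0-∣ₚ {d} d∣g d₀≈0))
                          (trans (sym (eval0-*ₚ d h)) (eval0-cong dh≈0∷f))
      dh'≈0∷f : (0# ∷ (d *ₚ drop 1 h)) ≈ₚ (0# ∷ f)
      dh'≈0∷f = ≈ₚ-trans (≈ₚ-sym (*ₚ-shift d (drop 1 h)))
                          (≈ₚ-trans (*ₚ-congˡ d (≈ₚ-sym (0∷-drop h h₀≈0))) dh≈0∷f)

module EuclideanReduction {q : ℕ} (F : FiniteField q) where

  open FiniteField F
  open Poly F
  open Polynomials F
  open Divisibility F
  open RingProperties (CommutativeRing.ring commRing) using (-‿distribʳ-*)
  open Setoid (⇔-setoid 0ℓ) using () renaming (refl to ⇔-refl; sym to ⇔-sym; trans to ⇔-trans)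
  module ⇔-Reasoning = SetoidReasoning (⇔-setoid 0ℓ)

  toList-cong : ∀ {n} {r r' : Vec Carrier n} → Pointwise _≈_ r r' → toList r ≈ₚ toList r'
  toList-cong []         = tt
  toList-cong (e ∷ r≈r') = e , toList-cong r≈r'

  monic-cong : ∀ {n} {d d' : Vec Carrier n} → Pointwise _≈_ d d' → monic d ≈ₚ monic d'
  monic-cong []         = refl , tt
  monic-cong (e ∷ d≈d') = e , monic-cong d≈d'

  monic≈toList-∷ʳ : ∀ {n} (d : Vec Carrier n) → monic d ≈ₚ toList (d ∷ʳ 1#)
  monic≈toList-∷ʳ d = ≈ₚ-reflexive (≡.sym (toList-∷ʳ 1# d))

  subtractScaled : ∀ {L} → Carrier → Vec Carrier L → Vec Carrier L → Vec Carrier L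
  subtractScaled t = zipWith (λ a b → a + - (b * t))

  subtractScaled-+ₚ : ∀ {L} (D V : Vec Carrier L) t →
    (toList (subtractScaled t D V) +ₚ map (_* t) (toList V ++ [ 1# ])) ≈ₚ (toList D ++ [ t ])
  subtractScaled-+ₚ []      []      t = *-identityˡ t , tt
  subtractScaled-+ₚ (a ∷ D) (b ∷ V) t =
    trans (+-assoc _ _ _) (trans (+-congˡ (-‿inverseˡ _)) (+-identityʳ a)) , subtractScaled-+ₚ D V t

  +ₚ-negScaled : ∀ {L} (D V : Vec Carrier L) t →
    ((toList D ++ [ t ]) +ₚ map (_* (- t)) (toList V ++ [ 1# ])) ≈ₚ toList (subtractScaled t D V)
  +ₚ-negScaled []      []      t = trans (+-congˡ (*-identityˡ _)) (-‿inverseʳ t) , tt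
  +ₚ-negScaled (a ∷ D) (b ∷ V) t = +-congˡ (sym (-‿distribʳ-* b t)) , +ₚ-negScaled D V t

  padLow : ∀ {m n} → m ≤′ n → Vec Carrier m → Vec Carrier n
  padLow ≤′-refl       cs = cs
  padLow (≤′-step m≤n) cs = 0# ∷ padLow m≤n cs

  monomial : ∀ {m n} → m ≤′ n → Carrier → Pol
  monomial ≤′-refl       s = [ s ]
  monomial (≤′-step m≤n) s = 0# ∷ monomial m≤n s

  -- For g = d ∷ʳ t of degree n and f = monic cs: the lower coefficients of g − t·Xⁿ⁻ᵐ·f
  reduceTop : ∀ {m n} → m ≤′ n → Vec Carrier m → Vec Carrier n → Carrier → Vec Carrier n
  reduceTop m≤n cs d t = subtractScaled t d (padLow m≤n cs)

  monic-*ₚ-monomial : ∀ {m n} (m≤n : m ≤′ n) (cs : Vec Carrier m) s →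
    (monic cs *ₚ monomial m≤n s) ≈ₚ map (_* s) (toList (padLow m≤n cs) ++ [ 1# ])
  monic-*ₚ-monomial ≤′-refl       cs s = *ₚ-constant (monic cs) s
  monic-*ₚ-monomial (≤′-step m≤n) cs s =
    ≈ₚ-trans (*ₚ-shift (monic cs) _) (sym (zeroˡ s) , monic-*ₚ-monomial m≤n cs s)

  Coprime-reduceTop : ∀ {m n} (m≤n : m ≤′ n) (cs : Vec Carrier m) d t →
    Coprime (monic cs) (toList (d ∷ʳ t)) ⇔ Coprime (monic cs) (toList (reduceTop m≤n cs d t))
  Coprime-reduceTop m≤n cs d t = mk⇔
    (Coprime-+ₚ-*ₚ (monomial m≤n t) (≈ₚ-trans
      (+ₚ-cong (≈ₚ-refl {toList (reduceTop m≤n cs d t)}) (monic-*ₚ-monomial m≤n cs t))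
      (≈ₚ-trans (subtractScaled-+ₚ d V t) (≈ₚ-reflexive (≡.sym (toList-∷ʳ t d))))))
    (Coprime-+ₚ-*ₚ (monomial m≤n (- t)) (≈ₚ-trans
      (+ₚ-cong (≈ₚ-reflexive (toList-∷ʳ t d)) (monic-*ₚ-monomial m≤n cs (- t)))
      (+ₚ-negScaled d V t)))
    where V = padLow m≤n cs

  Coprime-∷ʳ-zero : ∀ {n} f (d : Vec Carrier n) {t} → t ≈ 0# →
    Coprime f (toList (d ∷ʳ t)) ⇔ Coprime f (toList d)
  Coprime-∷ʳ-zero f d t≈0 =
    Coprime-congʳ (≈ₚ-trans (≈ₚ-reflexive (toList-∷ʳ _ d)) (∷ʳ-zero (toList d) t≈0))

  Coprime-∷ʳ-unit : ∀ {n} f (d : Vec Carrier n) {t y} → t * y ≈ 1# →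
    Coprime f (toList (d ∷ʳ t)) ⇔ Coprime f (monic (Vec.map (_* y) d))
  Coprime-∷ʳ-unit f d {t} {y} ty≈1 = mk⇔ (Coprime-*ₚ [ t ] dy·t≈d) (Coprime-*ₚ [ y ] d·y≈dy)
    where
    yt≈1 : y * t ≈ 1#
    yt≈1 = trans (*-comm y t) ty≈1
    d·y≈dy : (toList (d ∷ʳ t) *ₚ [ y ]) ≈ₚ monic (Vec.map (_* y) d)
    d·y≈dy = ≈ₚ-trans (*ₚ-constant _ y)
               (≈ₚ-trans (≈ₚ-reflexive (≡.cong (map (_* y)) (toList-∷ʳ t d))) (go d))
      where
      go : ∀ {n} (d : Vec Carrier n) → map (_* y) (toList d ++ [ t ]) ≈ₚ monic (Vec.map (_* y) d)
      go []      = ty≈1 , tt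
      go (x ∷ d) = refl , go d
    dy·t≈d : (monic (Vec.map (_* y) d) *ₚ [ t ]) ≈ₚ toList (d ∷ʳ t)
    dy·t≈d = ≈ₚ-trans (*ₚ-constant _ t) (≈ₚ-trans (go d) (≈ₚ-reflexive (≡.sym (toList-∷ʳ t d))))
      where
      go : ∀ {n} (d : Vec Carrier n) → map (_* t) (monic (Vec.map (_* y) d)) ≈ₚ (toList d ++ [ t ])
      go []      = *-identityˡ t , tt
      go (x ∷ d) = trans (*-assoc x y t) (trans (*-congˡ yt≈1) (*-identityʳ x)) , go d

  reduceMod : ∀ {m n} → m ≤′ n → (cs : Vec Carrier m) (r : Vec Carrier n) →
    Σ[ r' ∈ Vec Carrier m ] (Coprime (monic cs) (toList r) ⇔ Coprime (monic cs) (toList r'))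
  reduceMod ≤′-refl       cs r = r , ⇔-refl
  reduceMod (≤′-step m≤n) cs r with Vec.initLast r
  ... | d , t , ≡.refl with reduceMod m≤n cs (reduceTop m≤n cs d t)
  ...   | r' , e = r' , ⇔-trans (Coprime-reduceTop m≤n cs d t) e

  Coprime-euclidStep : ∀ {m n} (cs : Vec Carrier m) (d : Vec Carrier n) {t y} → t * y ≈ 1# → n ≤′ suc m →
    Σ[ r ∈ Vec Carrier n ]
      (Coprime (monic cs) (toList (d ∷ʳ t)) ⇔ Coprime (monic (Vec.map (_* y) d)) (toList r))
  Coprime-euclidStep cs d {t} {y} ty≈1 n≤1+m with reduceMod n≤1+m (Vec.map (_* y) d) (cs ∷ʳ 1#)
  ... | r , e = r , (begin
    Coprime (monic cs) (toList (d ∷ʳ t))    ≈⟨ Coprime-∷ʳ-unit (monic cs) d ty≈1 ⟩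
    Coprime (monic cs) (monic d')           ≈⟨ Coprime-comm ⟩
    Coprime (monic d') (monic cs)           ≈⟨ Coprime-congʳ (monic≈toList-∷ʳ cs) ⟩
    Coprime (monic d') (toList (cs ∷ʳ 1#))  ≈⟨ e ⟩
    Coprime (monic d') (toList r)           ∎)
    where
    d' = Vec.map (_* y) d
    open ⇔-Reasoning

  -- Euclid's algorithm; the fuel k bounds the degree of the monic argument, which drops at every swap
  coprime?-fuel : ∀ k {m n} (cs : Vec Carrier m) (r : Vec Carrier n) → m ≤ k → n ≤ m →
    Dec (Coprime (monic cs) (toList r))
  coprime?-fuel k       []       r  _         _         = yes (Coprime-oneₚ (toList r))
  coprime?-fuel k       (c ∷ cs) [] _         _         = no (monic-not-Coprime-[] c (toList cs))
  coprime?-fuel (suc k) cs       r  (s≤s m≤k) (s≤s n≤m) with Vec.initLast r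
  ... | d , t , ≡.refl with t ≈? 0#
  ...   | yes t≈0 = Dec.map (⇔-sym (Coprime-∷ʳ-zero (monic cs) d t≈0))
                      (coprime?-fuel (suc k) cs d (s≤s m≤k) (ℕₚ.m≤n⇒m≤1+n n≤m))
  ...   | no t≉0 with inverse t t≉0
  ...     | y , ty≈1 with Coprime-euclidStep cs d ty≈1 (ℕₚ.≤⇒≤′ (ℕₚ.m≤n⇒m≤1+n (ℕₚ.m≤n⇒m≤1+n n≤m)))
  ...       | r' , e =
    Dec.map (⇔-sym e) (coprime?-fuel k (Vec.map (_* y) d) r' (ℕₚ.≤-trans n≤m m≤k) ℕₚ.≤-refl)

  coprime? : ∀ {m n} (cs : Vec Carrier m) (r : Vec Carrier n) → Dec (Coprime (monic cs) (toList r))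
  coprime? {m} {n} cs r with n Nat.≤? m
  ... | yes n≤m = coprime?-fuel m cs r ℕₚ.≤-refl n≤m
  ... | no  n≰m with reduceMod (ℕₚ.≤⇒≤′ (ℕₚ.≰⇒≥ n≰m)) cs r
  ...   | r' , e = Dec.map (⇔-sym e) (coprime?-fuel m cs r' ℕₚ.≤-refl ℕₚ.≤-refl)

  coprimeMonic? : ∀ {m n} (cs : Vec Carrier m) (d : Vec Carrier n) → Dec (Coprime (monic cs) (monic d))
  coprimeMonic? cs d = Dec.map (Coprime-congʳ (≈ₚ-sym (monic≈toList-∷ʳ d))) (coprime? cs (d ∷ʳ 1#))

  BetaPred? : ∀ m n → Decidable (BetaPred m n)
  BetaPred? m n (c , d) = ¬? (eval0 (monic c) ≈? 0#) ×-dec coprimeMonic? c d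

  BetaPred-congˡ : ∀ {m n} {c c' : Vec Carrier m} {d : Vec Carrier n} → Pointwise _≈_ c c' →
    BetaPred m n (c , d) ⇔ BetaPred m n (c' , d)
  BetaPred-congˡ {c = c} {c'} c≈c' = mk⇔
    (λ (f₀≉0 , cop) → (λ f'₀≈0 → f₀≉0 (trans (eval0-cong f≈f') f'₀≈0))
                    , Equivalence.to (Coprime-congˡ f≈f') cop)
    (λ (f'₀≉0 , cop) → (λ f₀≈0 → f'₀≉0 (trans (eval0-cong (≈ₚ-sym f≈f')) f₀≈0))
                     , Equivalence.from (Coprime-congˡ f≈f') cop)
    where
    f≈f' : monic c ≈ₚ monic c'
    f≈f' = monic-cong c≈c'

module FieldPermutations {q : ℕ} (F : FiniteField q) where

  open FiniteField F

  permutation : (f g : Carrier → Carrier) →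
    (∀ {x y} → x ≈ y → f x ≈ f y) → (∀ {x y} → x ≈ y → g x ≈ g y) →
    (∀ x → f (g x) ≈ x) → (∀ x → g (f x) ≈ x) → Inverse setoid setoid
  permutation f g f-cong g-cong fg≈id gf≈id = record
    { to        = f
    ; from      = g
    ; to-cong   = f-cong
    ; from-cong = g-cong
    ; inverse   = (λ {x} y≈gx → trans (f-cong y≈gx) (fg≈id x))
                , (λ {x} y≈fx → trans (g-cong y≈fx) (gf≈id x))
    }

  translation : Carrier → Inverse setoid setoid
  translation u = permutation (λ a → a + - u) (_+ u) +-congʳ +-congʳ
    (λ x → trans (+-assoc _ _ _) (trans (+-congˡ (-‿inverseʳ u)) (+-identityʳ x)))
    (λ x → trans (+-assoc _ _ _) (trans (+-congˡ (-‿inverseˡ u)) (+-identityʳ x)))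

  scaling : ∀ {t y} → t * y ≈ 1# → Inverse setoid setoid
  scaling {t} {y} ty≈1 = permutation (_* y) (_* t) *-congʳ *-congʳ
    (λ x → trans (*-assoc x t y) (trans (*-congˡ ty≈1) (*-identityʳ x)))
    (λ x → trans (*-assoc x y t) (trans (*-congˡ (trans (*-comm y t) ty≈1)) (*-identityʳ x)))

Pointwise-∷ʳ : ∀ {a ℓ} {A : Set a} {R : A → A → Set ℓ} {n} {xs ys : Vec A n} {x y} →
  Pointwise R xs ys → R x y → Pointwise R (xs ∷ʳ x) (ys ∷ʳ y)
Pointwise-∷ʳ []          xRy = xRy ∷ []
Pointwise-∷ʳ (r ∷ xsRys) xRy = r ∷ Pointwise-∷ʳ xsRys xRy

module VectorSums {q : ℕ} (F : FiniteField q) where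

  open Nat using (_+_; _*_; _^_)
  open ≡ using (refl; sym; trans; cong; cong₂)
  open ≡.≡-Reasoning
  open FiniteField F using (Carrier; _≈_; _≈?_; 0#; setoid; elems; complete; distinct; card)
    renaming (refl to ≈-refl; sym to ≈-sym; trans to ≈-trans)
  open Poly F using (allVecs)

  sumVecs : ∀ k → (Vec Carrier k → ℕ) → ℕ
  sumVecs zero    G = G []
  sumVecs (suc k) G = ∑[ x ∈ elems ] sumVecs k (λ d → G (x ∷ d))

  sumVecs-cong : ∀ k {G H : Vec Carrier k → ℕ} → (∀ d → G d ≡ H d) → sumVecs k G ≡ sumVecs k H
  sumVecs-cong zero    G≗H = G≗H []
  sumVecs-cong (suc k) G≗H = sumOver-cong elems (λ x → sumVecs-cong k (λ d → G≗H (x ∷ d)))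

  sumOver-allVecs : ∀ k (G : Vec Carrier k → ℕ) → sumOver (allVecs k) G ≡ sumVecs k G
  sumOver-allVecs zero    G = ℕₚ.+-identityʳ (G [])
  sumOver-allVecs (suc k) G = trans (sumOver-concatMap (λ x → map (x ∷_) (allVecs k)) elems G)
    (sumOver-cong elems (λ x → trans (sumOver-map (x ∷_) (allVecs k) G) (sumOver-allVecs k (λ d → G (x ∷ d)))))

  sumVecs-+ : ∀ k (G H : Vec Carrier k → ℕ) → sumVecs k (λ d → G d + H d) ≡ sumVecs k G + sumVecs k H
  sumVecs-+ zero    G H = refl
  sumVecs-+ (suc k) G H = trans (sumOver-cong elems (λ x → sumVecs-+ k _ _)) (sumOver-+ elems _ _)

  sumVecs-*ˡ : ∀ k c (G : Vec Carrier k → ℕ) → sumVecs k (λ d → c * G d) ≡ c * sumVecs k G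
  sumVecs-*ˡ zero    c G = refl
  sumVecs-*ˡ (suc k) c G = trans (sumOver-cong elems (λ x → sumVecs-*ˡ k c _)) (sumOver-*ˡ elems c _)

  sumOver-elems-const : ∀ c → ∑[ _ ∈ elems ] c ≡ q * c
  sumOver-elems-const c = trans (sumOver-const elems c) (cong (_* c) card)

  sumVecs-const : ∀ k c → sumVecs k (λ _ → c) ≡ q ^ k * c
  sumVecs-const zero    c = sym (ℕₚ.+-identityʳ c)
  sumVecs-const (suc k) c = begin
    ∑[ _ ∈ elems ] sumVecs k (λ _ → c)   ≡⟨ sumOver-cong elems (λ _ → sumVecs-const k c) ⟩
    ∑[ _ ∈ elems ] (q ^ k * c)           ≡⟨ sumOver-elems-const _ ⟩
    q * (q ^ k * c)                      ≡⟨ ℕₚ.*-assoc q (q ^ k) c ⟨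
    q ^ suc k * c                        ∎

  sumVecs-zero : ∀ k (G : Vec Carrier k → ℕ) → (∀ d → G d ≡ 0) → sumVecs k G ≡ 0
  sumVecs-zero k G G≗0 = trans (sumVecs-cong k G≗0) (trans (sumVecs-const k 0) (ℕₚ.*-zeroʳ (q ^ k)))

  sumOver-sumVecs : ∀ {a} {A : Set a} (xs : List A) k (H : A → Vec Carrier k → ℕ) →
    ∑[ x ∈ xs ] sumVecs k (H x) ≡ sumVecs k (λ d → ∑[ x ∈ xs ] H x d)
  sumOver-sumVecs xs zero    H = refl
  sumOver-sumVecs xs (suc k) H = begin
    ∑[ x ∈ xs ] ∑[ y ∈ elems ] sumVecs k (λ d → H x (y ∷ d))
      ≡⟨ sumOver-swap xs elems _ ⟩
    ∑[ y ∈ elems ] ∑[ x ∈ xs ] sumVecs k (λ d → H x (y ∷ d))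
      ≡⟨ sumOver-cong elems (λ y → sumOver-sumVecs xs k (λ x d → H x (y ∷ d))) ⟩
    ∑[ y ∈ elems ] sumVecs k (λ d → ∑[ x ∈ xs ] H x (y ∷ d)) ∎

  sumVecs-swap : ∀ m n (G : Vec Carrier m → Vec Carrier n → ℕ) →
    sumVecs m (λ c → sumVecs n (G c)) ≡ sumVecs n (λ d → sumVecs m (λ c → G c d))
  sumVecs-swap zero    n G = refl
  sumVecs-swap (suc m) n G = trans (sumOver-cong elems (λ x → sumVecs-swap m n (λ c → G (x ∷ c))))
                                   (sumOver-sumVecs elems n _)

  sumVecs-∷ʳ : ∀ k (G : Vec Carrier (suc k) → ℕ) →
    sumVecs (suc k) G ≡ ∑[ t ∈ elems ] sumVecs k (λ d → G (d ∷ʳ t))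
  sumVecs-∷ʳ zero    G = refl
  sumVecs-∷ʳ (suc k) G = trans (sumOver-cong elems (λ x → sumVecs-∷ʳ k (λ d → G (x ∷ d))))
                               (sumOver-swap elems elems _)

  count-≈ : ∀ z → ∑[ x ∈ elems ] indicator (z ≈? x) ≡ 1
  count-≈ z = go elems (complete z) distinct
    where
    none : ∀ xs → All (λ y → ¬ (z ≈ y)) xs → ∑[ x ∈ xs ] indicator (z ≈? x) ≡ 0
    none []       []         = refl
    none (x ∷ xs) (z≉x ∷ ps) = trans (cong (_+ _) (indicator-no z≉x (z ≈? x))) (none xs ps)
    transport : ∀ {x} xs → z ≈ x → All (λ y → ¬ (x ≈ y)) xs → All (λ y → ¬ (z ≈ y)) xs
    transport xs z≈x = All.map (λ x≉y z≈y → x≉y (≈-trans (≈-sym z≈x) z≈y))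
    go : ∀ xs → Any (z ≈_) xs → AllPairs (λ x y → ¬ (x ≈ y)) xs → ∑[ x ∈ xs ] indicator (z ≈? x) ≡ 1
    go (x ∷ xs) (here z≈x)   (x≉xs ∷ _) =
      cong₂ _+_ (indicator-yes z≈x (z ≈? x)) (none xs (transport xs z≈x x≉xs))
    go (x ∷ xs) (there z∈xs) (x≉xs ∷ xs-distinct) =
      cong₂ _+_ (indicator-no (λ z≈x → All¬⇒¬Any (transport xs z≈x x≉xs) z∈xs) (z ≈? x))
                (go xs z∈xs xs-distinct)

  sumOver-elems-indicator-* : ∀ z (G : Carrier → ℕ) → G Preserves _≈_ ⟶ _≡_ →
    ∑[ y ∈ elems ] (indicator (z ≈? y) * G y) ≡ G z
  sumOver-elems-indicator-* z G G-resp = begin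
    ∑[ y ∈ elems ] (indicator (z ≈? y) * G y)  ≡⟨ sumOver-cong elems sift ⟩
    ∑[ y ∈ elems ] (indicator (z ≈? y) * G z)  ≡⟨ sumOver-*ʳ elems _ (G z) ⟩
    (∑[ y ∈ elems ] indicator (z ≈? y)) * G z  ≡⟨ cong (_* G z) (count-≈ z) ⟩
    1 * G z                                   ≡⟨ ℕₚ.*-identityˡ (G z) ⟩
    G z                                       ∎
    where
    sift : ∀ y → indicator (z ≈? y) * G y ≡ indicator (z ≈? y) * G z
    sift y with z ≈? y
    ... | yes z≈y = cong (1 *_) (G-resp (≈-sym z≈y))
    ... | no  _   = refl

  sumOver-elems-inverse : ∀ (π : Inverse setoid setoid) (G : Carrier → ℕ) → G Preserves _≈_ ⟶ _≡_ →
    ∑[ x ∈ elems ] G (Inverse.to π x) ≡ sumOver elems G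
  sumOver-elems-inverse π G G-resp = begin
    ∑[ x ∈ elems ] G (to x)
      ≡⟨ sumOver-cong elems (λ x → sumOver-elems-indicator-* (to x) G G-resp) ⟨
    ∑[ x ∈ elems ] ∑[ y ∈ elems ] (indicator (to x ≈? y) * G y)
      ≡⟨ sumOver-swap elems elems _ ⟩
    ∑[ y ∈ elems ] ∑[ x ∈ elems ] (indicator (to x ≈? y) * G y)
      ≡⟨ sumOver-cong elems (λ y → sumOver-cong elems (λ x → cong (_* G y) (moved x y))) ⟩
    ∑[ y ∈ elems ] ∑[ x ∈ elems ] (indicator (from y ≈? x) * G y)
      ≡⟨ sumOver-cong elems (λ y → sumOver-elems-indicator-* (from y) (λ _ → G y) (λ _ → refl)) ⟩
    sumOver elems G ∎
    where
    open Inverse π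
    moved : ∀ x y → indicator (to x ≈? y) ≡ indicator (from y ≈? x)
    moved x y = indicator-⇔ (mk⇔ (λ tx≈y → ≈-trans (from-cong (≈-sym tx≈y)) (strictlyInverseʳ x))
                                 (λ fy≈x → ≈-trans (to-cong (≈-sym fy≈x)) (strictlyInverseˡ y))) _ _

  sumOver-elems-split-0# : ∀ (G H : Carrier → ℕ) → G Preserves _≈_ ⟶ _≡_ → H Preserves _≈_ ⟶ _≡_ →
    (∀ x → ¬ (x ≈ 0#) → G x ≡ H x) → sumOver elems G + H 0# ≡ sumOver elems H + G 0#
  sumOver-elems-split-0# G H G-resp H-resp G≗H = begin
    sumOver elems G + H 0#
      ≡⟨ cong (sumOver elems G +_) (∑δ* (H 0#)) ⟨
    sumOver elems G + (∑[ x ∈ elems ] δ x) * H 0#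
      ≡⟨ cong (sumOver elems G +_) (sumOver-*ʳ elems δ (H 0#)) ⟨
    sumOver elems G + ∑[ x ∈ elems ] (δ x * H 0#)
      ≡⟨ sumOver-+ elems G _ ⟨
    ∑[ x ∈ elems ] (G x + δ x * H 0#)
      ≡⟨ sumOver-cong elems pointwise ⟩
    ∑[ x ∈ elems ] (H x + δ x * G 0#)
      ≡⟨ sumOver-+ elems H _ ⟩
    sumOver elems H + ∑[ x ∈ elems ] (δ x * G 0#)
      ≡⟨ cong (sumOver elems H +_) (sumOver-*ʳ elems δ (G 0#)) ⟩
    sumOver elems H + (∑[ x ∈ elems ] δ x) * G 0#
      ≡⟨ cong (sumOver elems H +_) (∑δ* (G 0#)) ⟩
    sumOver elems H + G 0# ∎
    where
    δ : Carrier → ℕ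
    δ x = indicator (0# ≈? x)
    ∑δ* : ∀ n → (∑[ x ∈ elems ] δ x) * n ≡ n
    ∑δ* n = trans (cong (_* n) (count-≈ 0#)) (ℕₚ.*-identityˡ n)
    pointwise : ∀ x → G x + δ x * H 0# ≡ H x + δ x * G 0#
    pointwise x with 0# ≈? x
    ... | yes 0≈x rewrite G-resp (≈-sym 0≈x) | H-resp (≈-sym 0≈x) =
      trans (ℕₚ.+-comm (G 0#) (H 0# + 0)) (cong₂ _+_ (ℕₚ.+-identityʳ (H 0#)) (sym (ℕₚ.+-identityʳ (G 0#))))
    ... | no  0≉x = cong (_+ 0) (G≗H x (λ x≈0 → 0≉x (≈-sym x≈0)))

  sumVecs-zipWith-inverse : ∀ (π : Carrier → Inverse setoid setoid) k (V : Vec Carrier k)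
    (G : Vec Carrier k → ℕ) → G Preserves Pointwise _≈_ ⟶ _≡_ →
    sumVecs k (λ d → G (zipWith (λ a b → Inverse.to (π b) a) d V)) ≡ sumVecs k G
  sumVecs-zipWith-inverse π zero    []      G G-resp = refl
  sumVecs-zipWith-inverse π (suc k) (b ∷ V) G G-resp = begin
    ∑[ x ∈ elems ] sumVecs k (λ d → G (to (π b) x ∷ zipWith _ d V))
      ≡⟨ sumOver-cong elems (λ x → sumVecs-zipWith-inverse π k V _ (λ e → G-resp (≈-refl ∷ e))) ⟩
    ∑[ x ∈ elems ] sumVecs k (λ d → G (to (π b) x ∷ d))
      ≡⟨ sumOver-elems-inverse (π b) _ (λ x≈y → sumVecs-cong k (λ d → G-resp (x≈y ∷ Pointwise.refl ≈-refl))) ⟩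
    ∑[ x ∈ elems ] sumVecs k (λ d → G (x ∷ d))
      ∎
    where open Inverse using (to)

  sumVecs-map-inverse : ∀ (π : Inverse setoid setoid) k (G : Vec Carrier k → ℕ) →
    G Preserves Pointwise _≈_ ⟶ _≡_ →
    sumVecs k (λ d → G (Vec.map (Inverse.to π) d)) ≡ sumVecs k G
  sumVecs-map-inverse π zero    G G-resp = refl
  sumVecs-map-inverse π (suc k) G G-resp = begin
    ∑[ x ∈ elems ] sumVecs k (λ d → G (to x ∷ Vec.map to d))
      ≡⟨ sumOver-cong elems (λ x → sumVecs-map-inverse π k _ (λ e → G-resp (≈-refl ∷ e))) ⟩
    ∑[ x ∈ elems ] sumVecs k (λ d → G (to x ∷ d))
      ≡⟨ sumOver-elems-inverse π _ (λ x≈y → sumVecs-cong k (λ d → G-resp (x≈y ∷ Pointwise.refl ≈-refl))) ⟩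
    ∑[ x ∈ elems ] sumVecs k (λ d → G (x ∷ d))
      ∎
    where open Inverse π using (to)

module BetaArithmetic where

  open Nat using (_+_; _*_; _^_; _∸_; _/_; _<?_)
  open ≡ using (refl; sym; trans; cong; cong₂; subst)
  open ≡.≡-Reasoning

  record Recurrences (q : ℕ) (#coprime #coprimeAny #beta : ℕ → ℕ → ℕ) : Set where
    field
      #coprimeAny-suc-high : ∀ {m n} → m ≤′ n → #coprimeAny m (suc n) ≡ q * #coprimeAny m n
      #coprimeAny-zeroʳ    : ∀ m → #coprimeAny (suc m) 0 ≡ 0
      #coprimeAny-suc      : ∀ m n → #coprimeAny m (suc n) + #coprime m n ≡ #coprimeAny m n + q * #coprime m n
      #coprime≡#coprimeAny : ∀ {m n} → m ≤′ n → #coprime m n ≡ #coprimeAny m n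
      #coprime-comm        : ∀ m n → #coprime m n ≡ #coprime n m
      #coprime-zeroˡ       : ∀ n → #coprime 0 n ≡ q ^ n
      #beta-zeroˡ          : ∀ n → #beta 0 n ≡ q ^ n
      #beta-split          : ∀ m n → #beta (suc m) n + #beta n m ≡ #coprime (suc m) n

  module ClosedForm (p : ℕ) {#coprime #coprimeAny #beta : ℕ → ℕ → ℕ}
                    (R : Recurrences (suc p) #coprime #coprimeAny #beta) where

    open Recurrences R

    q : ℕ
    q = suc p

    #coprime-zeroʳ : ∀ m → #coprime m 0 ≡ q ^ m
    #coprime-zeroʳ m = trans (#coprime-comm m 0) (#coprime-zeroˡ m)

    CoprimeFormulaHolds : ℕ → Set
    CoprimeFormulaHolds m = ∀ n → #coprime (suc m) (suc n) ≡ p * q ^ suc (m + n)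

    module _ (m : ℕ) (ih : ∀ {k} → k < m → CoprimeFormulaHolds k) where

      #coprime-via-comm : ∀ {k} → k < m → #coprime (suc m) (suc k) ≡ p * q ^ suc (m + k)
      #coprime-via-comm {k} k<m = begin
        #coprime (suc m) (suc k)   ≡⟨ #coprime-comm (suc m) (suc k) ⟩
        #coprime (suc k) (suc m)   ≡⟨ ih k<m m ⟩
        p * q ^ suc (k + m)        ≡⟨ cong (λ e → p * q ^ suc e) (ℕₚ.+-comm k m) ⟩
        p * q ^ suc (m + k)        ∎

      #coprimeAny-low : ∀ k → k ≤ m → #coprimeAny (suc m) (suc k) ≡ p * q ^ suc (m + k)
      #coprimeAny-low zero _ = ℕₚ.+-cancelʳ-≡ _ _ _ (begin
        #coprimeAny (suc m) 1 + Q
          ≡⟨ cong (#coprimeAny (suc m) 1 +_) (#coprime-zeroʳ (suc m)) ⟨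
        #coprimeAny (suc m) 1 + #coprime (suc m) 0
          ≡⟨ #coprimeAny-suc (suc m) 0 ⟩
        #coprimeAny (suc m) 0 + q * #coprime (suc m) 0
          ≡⟨ cong₂ (λ a b → a + q * b) (#coprimeAny-zeroʳ m) (#coprime-zeroʳ (suc m)) ⟩
        q * Q
          ≡⟨ identity p Q ⟩
        p * Q + Q
          ≡⟨ cong (λ e → p * q ^ suc e + Q) (ℕₚ.+-identityʳ m) ⟨
        p * q ^ suc (m + 0) + Q ∎)
        where
        Q = q ^ suc m
        identity : ∀ p Q → (1 + p) * Q ≡ p * Q + Q
        identity = solve-∀
      #coprimeAny-low (suc k) k<m = ℕₚ.+-cancelʳ-≡ _ _ _ (begin
        #coprimeAny (suc m) (suc (suc k)) + p * Q
          ≡⟨ cong (#coprimeAny (suc m) (suc (suc k)) +_) (#coprime-via-comm k<m) ⟨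
        #coprimeAny (suc m) (suc (suc k)) + #coprime (suc m) (suc k)
          ≡⟨ #coprimeAny-suc (suc m) (suc k) ⟩
        #coprimeAny (suc m) (suc k) + q * #coprime (suc m) (suc k)
          ≡⟨ cong₂ (λ a b → a + q * b) (#coprimeAny-low k (ℕₚ.<⇒≤ k<m)) (#coprime-via-comm k<m) ⟩
        p * Q + q * (p * Q)
          ≡⟨ identity p Q ⟩
        p * (q * Q) + p * Q
          ≡⟨ cong (λ e → p * q ^ suc e + p * Q) (ℕₚ.+-suc m k) ⟨
        p * q ^ suc (m + suc k) + p * Q
          ∎)
        where
        Q = q ^ suc (m + k)
        identity : ∀ p Q → p * Q + (1 + p) * (p * Q) ≡ p * ((1 + p) * Q) + p * Q
        identity = solve-∀

      #coprimeAny-high : ∀ {n} → m ≤′ n → #coprimeAny (suc m) (suc n) ≡ p * q ^ suc (m + n)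
      #coprimeAny-high ≤′-refl = #coprimeAny-low m ℕₚ.≤-refl
      #coprimeAny-high {suc n} (≤′-step m≤n) = begin
        #coprimeAny (suc m) (suc (suc n))   ≡⟨ #coprimeAny-suc-high (ℕₚ.s≤′s m≤n) ⟩
        q * #coprimeAny (suc m) (suc n)     ≡⟨ cong (q *_) (#coprimeAny-high m≤n) ⟩
        q * (p * q ^ suc (m + n))           ≡⟨ ℕₚ.*-comm q _ ⟩
        p * q ^ suc (m + n) * q             ≡⟨ ℕₚ.*-assoc p _ q ⟩
        p * (q ^ suc (m + n) * q)           ≡⟨ cong (p *_) (ℕₚ.*-comm _ q) ⟩
        p * q ^ suc (suc (m + n))           ≡⟨ cong (λ e → p * q ^ suc e) (ℕₚ.+-suc m n) ⟨
        p * q ^ suc (m + suc n)             ∎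

      #coprime-formula-step : CoprimeFormulaHolds m
      #coprime-formula-step n with m Nat.≤? n
      ... | yes m≤n =
        trans (#coprime≡#coprimeAny (ℕₚ.s≤′s (ℕₚ.≤⇒≤′ m≤n))) (#coprimeAny-high (ℕₚ.≤⇒≤′ m≤n))
      ... | no  m≰n = #coprime-via-comm (ℕₚ.≰⇒> m≰n)

    coprimeFormula : ℕ → ℕ → ℕ
    coprimeFormula m zero    = q ^ suc m
    coprimeFormula m (suc n) = p * q ^ suc (m + n)

    #coprime-closed : ∀ m n → #coprime (suc m) n ≡ coprimeFormula m n
    #coprime-closed m zero    = #coprime-zeroʳ (suc m)
    #coprime-closed m (suc n) = <-rec CoprimeFormulaHolds (λ m ih → #coprime-formula-step m ih) m n

    -- (q²ᵏ − 1)/(q + 1), computed without division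
    evenQuotient : ℕ → ℕ
    evenQuotient zero    = 0
    evenQuotient (suc k) = p + q * q * evenQuotient k

    q^[2k] : ∀ k → q ^ (2 * k) ≡ 1 + suc q * evenQuotient k
    q^[2k] zero    = cong (1 +_) (sym (ℕₚ.*-zeroʳ (suc q)))
    q^[2k] (suc k) = begin
      q ^ (2 * suc k)                          ≡⟨ cong (q ^_) (ℕₚ.*-suc 2 k) ⟩
      q * (q * q ^ (2 * k))                    ≡⟨ cong (λ e → q * (q * e)) (q^[2k] k) ⟩
      q * (q * (1 + suc q * evenQuotient k))   ≡⟨ identity p (evenQuotient k) ⟩
      1 + suc q * evenQuotient (suc k)         ∎
      where
      identity : ∀ p a → (1 + p) * ((1 + p) * (1 + (2 + p) * a)) ≡ 1 + (2 + p) * (p + (1 + p) * (1 + p) * a)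
      identity = solve-∀

    q^[2k+1]+1 : ∀ k → q ^ (2 * k + 1) + 1 ≡ (1 + q * evenQuotient k) * suc q
    q^[2k+1]+1 k = begin
      q ^ (2 * k + 1) + 1                  ≡⟨ cong (λ e → q ^ e + 1) (ℕₚ.+-comm (2 * k) 1) ⟩
      q * q ^ (2 * k) + 1                  ≡⟨ cong (λ e → q * e + 1) (q^[2k] k) ⟩
      q * (1 + suc q * evenQuotient k) + 1 ≡⟨ identity p (evenQuotient k) ⟩
      (1 + q * evenQuotient k) * suc q     ∎
      where
      identity : ∀ p a → (1 + p) * (1 + (2 + p) * a) + 1 ≡ (1 + (1 + p) * a) * (2 + p)
      identity = solve-∀

    betaFormula-≤ : ∀ {m n} → n ≤ m → betaFormula q (suc m) n ≡ q ^ (m ∸ n) * p * (1 + q * evenQuotient n)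
    betaFormula-≤ {m} {n} n≤m with n <? suc m
    ... | no  n≮1+m = contradiction (s≤s n≤m) n≮1+m
    ... | yes _     = cong₂ (λ e c → q ^ e * p * c) (cong (_∸ 1) (ℕₚ.+-∸-assoc 1 n≤m)) quotient
      where
      quotient : (q ^ (2 * n + 1) + 1) / suc q ≡ 1 + q * evenQuotient n
      quotient = trans (cong (_/ suc q) (q^[2k+1]+1 n)) (m*n/n≡m _ (suc q))

    betaFormula-> : ∀ {m n} → suc m ≤ n → betaFormula q (suc m) n ≡ q ^ (n ∸ suc m) * p * evenQuotient (suc m)
    betaFormula-> {m} {n} m<n with n <? suc m
    ... | yes n<1+m = contradiction m<n (ℕₚ.<⇒≱ n<1+m)
    ... | no  _     = cong (q ^ (n ∸ suc m) * p *_) quotient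
      where
      quotient : (q ^ (2 * suc m) ∸ 1) / suc q ≡ evenQuotient (suc m)
      quotient rewrite q^[2k] (suc m) =
        trans (cong (_/ suc q) (ℕₚ.*-comm (suc q) (evenQuotient (suc m)))) (m*n/n≡m _ (suc q))

    q^-+ : ∀ a b c → a + b ≡ c → q ^ a * q ^ b ≡ q ^ c
    q^-+ a b c a+b≡c = trans (sym (ℕₚ.^-distribˡ-+-* q a b)) (cong (q ^_) a+b≡c)

    betaFormula-split : ∀ m n → betaFormula q (suc m) n + betaFormula q n m ≡ coprimeFormula m n
    betaFormula-split m zero = trans (cong (_+ q ^ m) (betaFormula-≤ {m} z≤n)) (identity p (q ^ m))
      where
      identity : ∀ p Q → Q * p * (1 + (1 + p) * 0) + Q ≡ (1 + p) * Q
      identity = solve-∀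
    betaFormula-split m (suc n) with suc n Nat.≤? m
    ... | yes n<m = begin
      betaFormula q (suc m) (suc n) + betaFormula q (suc n) m
        ≡⟨ cong₂ _+_ (betaFormula-≤ n<m) (betaFormula-> n<m) ⟩
      q ^ d * p * (1 + q * A) + q ^ d * p * A
        ≡⟨ identity p (q ^ d) A ⟩
      p * (q ^ d * (1 + suc q * A))
        ≡⟨ cong (λ e → p * (q ^ d * e)) (q^[2k] (suc n)) ⟨
      p * (q ^ d * q ^ (2 * suc n))
        ≡⟨ cong (p *_) (q^-+ d (2 * suc n) (suc (m + n)) exponent) ⟩
      p * q ^ suc (m + n) ∎
      where
      d = m ∸ suc n
      A = evenQuotient (suc n)
      identity : ∀ p Q a → Q * p * (1 + (1 + p) * a) + Q * p * a ≡ p * (Q * (1 + (2 + p) * a))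
      identity = solve-∀
      exponent : d + 2 * suc n ≡ suc (m + n)
      exponent = trans (shuffle n d) (cong (λ e → suc (e + n)) (ℕₚ.m∸n+n≡m n<m))
        where
        shuffle : ∀ n d → d + 2 * (1 + n) ≡ 1 + ((d + (1 + n)) + n)
        shuffle = solve-∀
    ... | no  n≮m = begin
      betaFormula q (suc m) (suc n) + betaFormula q (suc n) m
        ≡⟨ cong₂ _+_ (betaFormula-> (s≤s m≤n)) (betaFormula-≤ m≤n) ⟩
      q ^ d * p * evenQuotient (suc m) + q ^ d * p * (1 + q * A)
        ≡⟨ identity p (q ^ d) A ⟩
      p * (q ^ d * (q * (1 + suc q * A)))
        ≡⟨ cong (λ e → p * (q ^ d * (q * e))) (q^[2k] m) ⟨
      p * (q ^ d * q ^ suc (2 * m))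
        ≡⟨ cong (p *_) (q^-+ d (suc (2 * m)) (suc (m + n)) exponent) ⟩
      p * q ^ suc (m + n) ∎
      where
      m≤n = ℕₚ.≮⇒≥ n≮m
      d = n ∸ m
      A = evenQuotient m
      identity : ∀ p Q a → Q * p * (p + (1 + p) * (1 + p) * a) + Q * p * (1 + (1 + p) * a)
                         ≡ p * (Q * ((1 + p) * (1 + (2 + p) * a)))
      identity = solve-∀
      exponent : d + suc (2 * m) ≡ suc (m + n)
      exponent = trans (shuffle m d) (cong (λ e → suc (m + e)) (ℕₚ.m∸n+n≡m m≤n))
        where
        shuffle : ∀ m d → d + (1 + 2 * m) ≡ 1 + (m + (d + m))
        shuffle = solve-∀

    #beta-closed : ∀ m n → #beta m n ≡ betaFormula q m n
    #beta-closed m n = go (m + n) m n ℕₚ.≤-refl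
      where
      go : ∀ N m n → m + n ≤ N → #beta m n ≡ betaFormula q m n
      go N       zero    n _               = #beta-zeroˡ n
      go (suc N) (suc m) n (s≤s m+n≤N) = ℕₚ.+-cancelʳ-≡ _ _ _ (begin
        #beta (suc m) n + betaFormula q n m
          ≡⟨ cong (#beta (suc m) n +_) (go N n m (subst (_≤ N) (ℕₚ.+-comm m n) m+n≤N)) ⟨
        #beta (suc m) n + #beta n m
          ≡⟨ #beta-split m n ⟩
        #coprime (suc m) n
          ≡⟨ #coprime-closed m n ⟩
        coprimeFormula m n
          ≡⟨ betaFormula-split m n ⟨
        betaFormula q (suc m) n + betaFormula q n m ∎)

open BetaArithmetic using (Recurrences; module ClosedForm)

module Counts {q : ℕ} (F : FiniteField q) where

  open Nat using (_+_; _*_; _^_)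
  open ≡ using (refl; sym; trans; cong; cong₂)
  open ≡.≡-Reasoning
  open FiniteField F using (Carrier; _≈_; _≈?_; 0#; 1#; 1≉0; inverse; elems; complete; card)
    renaming (refl to ≈-refl; _*_ to _·_)
  open Poly F
  open Divisibility F
  open EuclideanReduction F
  open FieldPermutations F
  open VectorSums F

  𝟙-coprime : ∀ {m n} → Vec Carrier m → Vec Carrier n → ℕ
  𝟙-coprime cs r = indicator (coprime? cs r)

  𝟙-coprimeMonic : ∀ {m n} → Vec Carrier m → Vec Carrier n → ℕ
  𝟙-coprimeMonic cs d = indicator (coprimeMonic? cs d)

  𝟙-beta : ∀ {m n} → Vec Carrier m → Vec Carrier n → ℕ
  𝟙-beta {m} {n} cs d = indicator (BetaPred? m n (cs , d))

  #coprime #coprimeAny #beta : ℕ → ℕ → ℕ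
  #coprime    m n = sumVecs m (λ c → sumVecs n (𝟙-coprimeMonic c))
  #coprimeAny m n = sumVecs m (λ c → sumVecs n (𝟙-coprime c))
  #beta       m n = sumVecs m (λ c → sumVecs n (𝟙-beta c))

  𝟙-coprime-resp : ∀ {m n} (cs : Vec Carrier m) → 𝟙-coprime {n = n} cs Preserves Pointwise _≈_ ⟶ _≡_
  𝟙-coprime-resp cs r≈r' = indicator-⇔ (Coprime-congʳ (toList-cong r≈r')) _ _

  𝟙-coprimeMonic-resp : ∀ {m n} (cs : Vec Carrier m) →
    𝟙-coprimeMonic {n = n} cs Preserves Pointwise _≈_ ⟶ _≡_
  𝟙-coprimeMonic-resp cs d≈d' = indicator-⇔ (Coprime-congʳ (monic-cong d≈d')) _ _

  sumVecs-leading : ∀ {m n} → m ≤′ n → (cs : Vec Carrier m) → ∀ t →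
    sumVecs n (λ d → 𝟙-coprime cs (d ∷ʳ t)) ≡ sumVecs n (𝟙-coprime cs)
  sumVecs-leading {n = n} m≤n cs t = trans
    (sumVecs-cong n (λ d → indicator-⇔ (Coprime-reduceTop m≤n cs d t) _ _))
    (sumVecs-zipWith-inverse (λ b → translation (b · t)) n (padLow m≤n cs) (𝟙-coprime cs) (𝟙-coprime-resp cs))

  #coprimeAny-suc-high : ∀ {m n} → m ≤′ n → #coprimeAny m (suc n) ≡ q * #coprimeAny m n
  #coprimeAny-suc-high {m} {n} m≤n = trans (sumVecs-cong m count) (sumVecs-*ˡ m q _)
    where
    count : ∀ cs → sumVecs (suc n) (𝟙-coprime cs) ≡ q * sumVecs n (𝟙-coprime cs)
    count cs = begin
      sumVecs (suc n) (𝟙-coprime cs)                          ≡⟨ sumVecs-∷ʳ n (𝟙-coprime cs) ⟩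
      ∑[ t ∈ elems ] sumVecs n (λ d → 𝟙-coprime cs (d ∷ʳ t))  ≡⟨ sumOver-cong elems (sumVecs-leading m≤n cs) ⟩
      ∑[ t ∈ elems ] sumVecs n (𝟙-coprime cs)                 ≡⟨ sumOver-elems-const _ ⟩
      q * sumVecs n (𝟙-coprime cs)                            ∎

  #coprime≡#coprimeAny : ∀ {m n} → m ≤′ n → #coprime m n ≡ #coprimeAny m n
  #coprime≡#coprimeAny {m} {n} m≤n = sumVecs-cong m λ cs → trans
    (sumVecs-cong n (λ d → indicator-⇔ (Coprime-congʳ (monic≈toList-∷ʳ d)) _ _))
    (sumVecs-leading m≤n cs 1#)

  #coprimeAny-zeroʳ : ∀ m → #coprimeAny (suc m) 0 ≡ 0
  #coprimeAny-zeroʳ m = sumVecs-zero (suc m) (λ cs → 𝟙-coprime cs []) λ where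
    (c ∷ cs) → indicator-no (monic-not-Coprime-[] c (toList cs)) (coprime? (c ∷ cs) [])

  #coprimeAny-suc : ∀ m n → #coprimeAny m (suc n) + #coprime m n ≡ #coprimeAny m n + q * #coprime m n
  #coprimeAny-suc m n = begin
    #coprimeAny m (suc n) + #coprime m n
      ≡⟨ sumVecs-+ m _ _ ⟨
    sumVecs m (λ cs → sumVecs (suc n) (𝟙-coprime cs) + sumVecs n (𝟙-coprimeMonic cs))
      ≡⟨ sumVecs-cong m count ⟩
    sumVecs m (λ cs → sumVecs n (𝟙-coprime cs) + q * sumVecs n (𝟙-coprimeMonic cs))
      ≡⟨ sumVecs-+ m _ _ ⟩
    #coprimeAny m n + sumVecs m (λ cs → q * sumVecs n (𝟙-coprimeMonic cs))
      ≡⟨ cong (#coprimeAny m n +_) (sumVecs-*ˡ m q _) ⟩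
    #coprimeAny m n + q * #coprime m n
      ∎
    where
    count : ∀ cs → sumVecs (suc n) (𝟙-coprime cs) + sumVecs n (𝟙-coprimeMonic cs)
                 ≡ sumVecs n (𝟙-coprime cs) + q * sumVecs n (𝟙-coprimeMonic cs)
    count cs = begin
      sumVecs (suc n) (𝟙-coprime cs) + K  ≡⟨ cong (_+ K) (sumVecs-∷ʳ n (𝟙-coprime cs)) ⟩
      sumOver elems G + K                 ≡⟨ sumOver-elems-split-0# G (λ _ → K) G-resp (λ _ → refl) G-unit ⟩
      ∑[ _ ∈ elems ] K + G 0#             ≡⟨ cong₂ _+_ (sumOver-elems-const K) G-zero ⟩
      q * K + sumVecs n (𝟙-coprime cs)    ≡⟨ ℕₚ.+-comm (q * K) _ ⟩
      sumVecs n (𝟙-coprime cs) + q * K    ∎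
      where
      K = sumVecs n (𝟙-coprimeMonic cs)
      G : Carrier → ℕ
      G t = sumVecs n (λ d → 𝟙-coprime cs (d ∷ʳ t))
      G-resp : G Preserves _≈_ ⟶ _≡_
      G-resp t≈t' = sumVecs-cong n (λ d → 𝟙-coprime-resp cs (Pointwise-∷ʳ (Pointwise.refl ≈-refl) t≈t'))
      G-zero : G 0# ≡ sumVecs n (𝟙-coprime cs)
      G-zero = sumVecs-cong n (λ d → indicator-⇔ (Coprime-∷ʳ-zero (monic cs) d ≈-refl) _ _)
      G-unit : ∀ t → ¬ (t ≈ 0#) → G t ≡ K
      G-unit t t≉0 with inverse t t≉0
      ... | y , ty≈1 = trans (sumVecs-cong n (λ d → indicator-⇔ (Coprime-∷ʳ-unit (monic cs) d ty≈1) _ _))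
                             (sumVecs-map-inverse (scaling ty≈1) n (𝟙-coprimeMonic cs) (𝟙-coprimeMonic-resp cs))

  #coprime-comm : ∀ m n → #coprime m n ≡ #coprime n m
  #coprime-comm m n = trans (sumVecs-swap m n _)
    (sumVecs-cong n (λ d → sumVecs-cong m (λ c → indicator-⇔ Coprime-comm _ _)))

  #coprime-zeroˡ : ∀ n → #coprime 0 n ≡ q ^ n
  #coprime-zeroˡ n = trans (sumVecs-cong n (λ d → indicator-yes (Coprime-oneₚ (monic d)) (coprimeMonic? [] d)))
                          (trans (sumVecs-const n 1) (ℕₚ.*-identityʳ _))

  #beta-zeroˡ : ∀ n → #beta 0 n ≡ q ^ n
  #beta-zeroˡ n = trans (sumVecs-cong n (λ d → indicator-yes (1≉0 , Coprime-oneₚ (monic d)) _))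
                       (trans (sumVecs-const n 1) (ℕₚ.*-identityʳ _))

  #beta-split : ∀ m n → #beta (suc m) n + #beta n m ≡ #coprime (suc m) n
  #beta-split m n = begin
    sumOver elems B + #beta n m   ≡⟨ cong (sumOver elems B +_) C-zero ⟨
    sumOver elems B + C 0#        ≡⟨ sumOver-elems-split-0# B C B-resp C-resp B≗C ⟩
    sumOver elems C + B 0#        ≡⟨ cong (sumOver elems C +_) B-zero ⟩
    sumOver elems C + 0           ≡⟨ ℕₚ.+-identityʳ _ ⟩
    #coprime (suc m) n            ∎
    where
    B C : Carrier → ℕ
    B x = sumVecs m (λ c → sumVecs n (𝟙-beta (x ∷ c)))
    C x = sumVecs m (λ c → sumVecs n (𝟙-coprimeMonic (x ∷ c)))
    B-resp : B Preserves _≈_ ⟶ _≡_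
    B-resp x≈x' = sumVecs-cong m λ c → sumVecs-cong n λ d →
      indicator-⇔ (BetaPred-congˡ (x≈x' ∷ Pointwise.refl ≈-refl)) _ _
    C-resp : C Preserves _≈_ ⟶ _≡_
    C-resp x≈x' = sumVecs-cong m λ c → sumVecs-cong n λ d →
      indicator-⇔ (Coprime-congˡ (monic-cong (x≈x' ∷ Pointwise.refl ≈-refl))) _ _
    B≗C : ∀ x → ¬ (x ≈ 0#) → B x ≡ C x
    B≗C x x≉0 = sumVecs-cong m λ c → sumVecs-cong n λ d → indicator-⇔ (mk⇔ proj₂ (x≉0 ,_)) _ _
    B-zero : B 0# ≡ 0
    B-zero = sumVecs-zero m _ λ c → sumVecs-zero n (𝟙-beta (0# ∷ c)) λ d →
      indicator-no (λ (0≉0 , _) → 0≉0 ≈-refl) _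
    C-zero : C 0# ≡ #beta n m
    C-zero = trans (sumVecs-cong m λ c → sumVecs-cong n λ d → indicator-⇔ (X*f-coprime c d) _ _)
                   (sumVecs-swap m n (λ c d → 𝟙-beta d c))
      where
      X*f-coprime : ∀ c d → Coprime (0# ∷ monic c) (monic d) ⇔ BetaPred n m (d , c)
      X*f-coprime c d = mk⇔
        (λ cop → let (fg , g₀≉0) = Equivalence.to (Coprime-Xₚ-*ₚ _ _) cop
                 in g₀≉0 , Equivalence.to Coprime-comm fg)
        (λ (g₀≉0 , gf) → Equivalence.from (Coprime-Xₚ-*ₚ _ _) (Equivalence.to Coprime-comm gf , g₀≉0))

  recurrences : Recurrences q #coprime #coprimeAny #beta
  recurrences = record
    { #coprimeAny-suc-high = #coprimeAny-suc-high
    ; #coprimeAny-zeroʳ    = #coprimeAny-zeroʳ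
    ; #coprimeAny-suc      = #coprimeAny-suc
    ; #coprime≡#coprimeAny = #coprime≡#coprimeAny
    ; #coprime-comm        = #coprime-comm
    ; #coprime-zeroˡ       = #coprime-zeroˡ
    ; #beta-zeroˡ          = #beta-zeroˡ
    ; #beta-split          = #beta-split
    }

  BetaIs-#beta : ∀ m n → BetaIs m n (#beta m n)
  BetaIs-#beta m n = BetaPred? m n , (begin
    length (filter (BetaPred? m n) (cartesianProduct (allVecs m) (allVecs n)))
      ≡⟨ length-filter≡sumOver-indicator (BetaPred? m n) (cartesianProduct (allVecs m) (allVecs n)) ⟩
    sumOver (cartesianProduct (allVecs m) (allVecs n)) (λ cd → indicator (BetaPred? m n cd))
      ≡⟨ sumOver-cartesianProduct (allVecs m) (allVecs n) _ ⟩
    ∑[ c ∈ allVecs m ] ∑[ d ∈ allVecs n ] 𝟙-beta c d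
      ≡⟨ sumOver-cong (allVecs m) (λ c → sumOver-allVecs n (𝟙-beta c)) ⟩
    ∑[ c ∈ allVecs m ] sumVecs n (𝟙-beta c)
      ≡⟨ sumOver-allVecs m _ ⟩
    #beta m n ∎)

  -- complete 0# rules out an empty enumeration
  size≡suc : Σ[ p ∈ ℕ ] q ≡ suc p
  size≡suc with elems | complete 0# | card
  ... | x ∷ xs | _ | |elems|≡q = length xs , sym |elems|≡q

BetaIs-betaFormula : ∀ {p} (F : FiniteField (suc p)) m n → Poly.BetaIs F m n (betaFormula (suc p) m n)
BetaIs-betaFormula {p} F m n = ≡.subst (BetaIs m n) (#beta-closed m n) (BetaIs-#beta m n)
  where
  open Poly F using (BetaIs)
  open Counts F using (BetaIs-#beta; recurrences)
  open ClosedForm p recurrences using (#beta-closed)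

-- The prime-power hypothesis is unused: the count only needs a finite field, whose size is at least 1.
lemmaA3 : (q : ℕ) → IsPrimePower q → (F : FiniteField q) →
    (m n : ℕ) → Poly.BetaIs F m n (betaFormula q m n)
lemmaA3 q _ F m n with Counts.size≡suc F
... | p , ≡.refl = BetaIs-betaFormula F m n
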